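{- Let $(A,B)$ be a bimatrix game with $A,B\in\mathbb{Q}_{\ge0}^{k\times n}$. Call two columns $i,j\in[n]$ equivalent if $A_{*,i}=A_{*,j}$ (the $i$-th and $j$-th columns of $A$ coincide). For every Nash equilibrium $(x,y)$ of the game there is a Nash equilibrium in which the column player's support contains at most one column from each equivalence class.
   Context: Bimatrix game: the row player picks a probability vector $x$ over rows $[k]$, the column player a probability vector $y$ over columns $[n]$; payoffs $x^TAy$ (row player) and $x^TBy$ (column player). $(x,y)$ is a Nash equilibrium if neither player can strictly increase his payoff by unilaterally changing his strategy. The support of $y$ is $S(y)=\{j:y_j>0\}$. -}

module Defs where

open import Data.Nat using (ℕ; zero; suc)
open import Data.Fin using (Fin; zero; suc)
open import Data.Rational using (ℚ; 0ℚ; 1ℚ; _+_; _*_; _≤_; _<_)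
open import Relation.Binary.PropositionalEquality using (_≡_)
open import Data.Product using (_×_)

∑ : (n : ℕ) → (Fin n → ℚ) → ℚ
∑ zero    f = 0ℚ
∑ (suc n) f = f zero + ∑ n (λ i → f (suc i))

Matrix : ℕ → ℕ → Set
Matrix k n = Fin k → Fin n → ℚ

NonNegMatrix : {k n : ℕ} → Matrix k n → Set
NonNegMatrix {k} {n} M = (i : Fin k) (j : Fin n) → 0ℚ ≤ M i j

IsMixed : (m : ℕ) → (Fin m → ℚ) → Set
IsMixed m x = ((i : Fin m) → 0ℚ ≤ x i) × (∑ m x ≡ 1ℚ)

payoff : {k n : ℕ} → Matrix k n → (Fin k → ℚ) → (Fin n → ℚ) → ℚ
payoff {k} {n} M x y = ∑ k (λ i → ∑ n (λ j → x i * M i j * y j))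

IsNash : {k n : ℕ} → Matrix k n → Matrix k n → (Fin k → ℚ) → (Fin n → ℚ) → Set
IsNash {k} {n} A B x y =
  IsMixed k x × IsMixed n y ×
  ((x' : Fin k → ℚ) → IsMixed k x' → payoff A x' y ≤ payoff A x y) ×
  ((y' : Fin n → ℚ) → IsMixed n y' → payoff B x y' ≤ payoff B x y)

SameColumn : {k n : ℕ} → Matrix k n → Fin n → Fin n → Set
SameColumn {k} A i j = (r : Fin k) → A r i ≡ A r j

InSupport : {n : ℕ} → (Fin n → ℚ) → Fin n → Set
InSupport y j = 0ℚ < y j

AtMostOnePerClass : {k n : ℕ} → Matrix k n → (Fin n → ℚ) → Set
AtMostOnePerClass {k} {n} A y =
  (i j : Fin n) → InSupport y i → InSupport y j → SameColumn A i j → i ≡ j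

-- Write a payoff as  payoff M x y = y · c,  where c l is the payoff of the
-- pure column l against x.  Moving all mass of column i onto column j
-- (the "transfer" of i to j) changes  y · c  by  y i * (c j - c i).  At an
-- equilibrium every support column is a best reply, so two support
-- columns earn the same B-payoff; if their A-columns also coincide, the
-- transfer changes no payoff of either player, hence preserves the
-- equilibrium, while i leaves the support.  Well-founded recursion on the
-- support (ordered by strict inclusion) repeats this until no two distinct
-- support columns share an A-column; x is never changed.
module Submission where

open import Defs
open import Data.Nat using (ℕ; zero; suc)
open import Data.Fin using (Fin; zero; suc)
open import Data.Fin.Properties using (any?; all?) renaming (_≟_ to _≟ᶠ_)
open import Data.Fin.Subset using (Subset; _∈_; _⊂_)
open import Data.Fin.Subset.Induction using (⊂-wellFounded)
open import Data.Vec using (tabulate)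
open import Data.Vec.Properties using (lookup∘tabulate; []=⇒lookup; lookup⇒[]=)
open import Data.Rational using (ℚ; 0ℚ; 1ℚ; _+_; _*_; _-_; -_; _≤_; _<_; positive)
open import Data.Rational.Properties
  using (_≟_; _<?_; +-*-commutativeRing; *-comm; *-zeroˡ; *-identityʳ;
         ≤-refl; ≤-antisym; <-irrefl; +-mono-≤; +-monoˡ-≤; *-cancelˡ-≤-pos)
open import Data.Rational.Solver using (module +-*-Solver)
open import Data.Product using (Σ; _×_; _,_)
open import Algebra.Bundles using (CommutativeRing)
open import Induction.WellFounded using (Acc; acc; WellFounded)
open import Relation.Binary.Construct.On using () renaming (wellFounded to wellFounded-on)
open import Relation.Binary.PropositionalEquality
open import Relation.Nullary using (¬_; Dec; yes; no)
open import Relation.Nullary.Decidable using (_×-dec_; ¬?; isYes; toWitness; fromWitness)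
open import Data.Bool.Properties using (T-≡)
open import Function.Bundles using (Equivalence)
open import Data.Empty using (⊥-elim)

open import Algebra.Properties.Semiring.Sum (CommutativeRing.semiring +-*-commutativeRing)
  using (sum; sum-syntax; sum-cong-≗; ∑-distrib-+; ∑-comm; *-distribˡ-sum)
open +-*-Solver

∑≡sum : ∀ n (f : Fin n → ℚ) → ∑ n f ≡ sum f
∑≡sum zero    f = refl
∑≡sum (suc n) f = cong (f zero +_) (∑≡sum n (λ i → f (suc i)))

+-cancelˡ-≤ : ∀ u p q → u + p ≤ u + q → p ≤ q
+-cancelˡ-≤ u p q h = subst₂ _≤_
  (solve 2 (λ u p → u :+ p :+ (:- u) := p) refl u p)
  (solve 2 (λ u q → u :+ q :+ (:- u) := q) refl u q)
  (+-monoˡ-≤ (- u) h)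

gain-bound : ∀ u a p q → 0ℚ < a → u + a * (p - q) ≤ u → p ≤ q
gain-bound u a p q a>0 h = *-cancelˡ-≤-pos a {{positive a>0}}
  (+-cancelˡ-≤ u (a * p) (a * q) (subst₂ _≤_
    (solve 4 (λ u a p q → u :+ a :* (p :- q) :+ a :* q := u :+ a :* p) refl u a p q)
    (solve 3 (λ u a q → u :+ a :* q := u :+ a :* q) refl u a q)
    (+-monoˡ-≤ (a * q) h)))

_·_ : ∀ {n} → (Fin n → ℚ) → (Fin n → ℚ) → ℚ
_·_ {n} y c = ∑[ l < n ] (y l * c l)

colPayoff : ∀ {k n} → Matrix k n → (Fin k → ℚ) → Fin n → ℚ
colPayoff {k} M x l = ∑[ r < k ] (x r * M r l)

payoff-by-columns : ∀ {k n} (M : Matrix k n) x y → payoff M x y ≡ y · colPayoff M x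
payoff-by-columns {k} {n} M x y = begin
  payoff M x y
    ≡⟨ trans (∑≡sum k _) (sum-cong-≗ (λ r → ∑≡sum n (λ l → x r * M r l * y l))) ⟩
  ∑[ r < k ] (∑[ l < n ] (x r * M r l * y l))
    ≡⟨ ∑-comm (λ r l → x r * M r l * y l) ⟩
  ∑[ l < n ] (∑[ r < k ] (x r * M r l * y l))
    ≡⟨ sum-cong-≗ (λ l → trans (sum-cong-≗ (λ r → *-comm (x r * M r l) (y l)))
                                (sym (*-distribˡ-sum (y l) (λ r → x r * M r l)))) ⟩
  y · colPayoff M x ∎
  where open ≡-Reasoning

same-column-payoff : ∀ {k n} (M : Matrix k n) x {i j} → SameColumn M i j →
  colPayoff M x i ≡ colPayoff M x j
same-column-payoff M x same = sum-cong-≗ (λ r → cong (x r *_) (same r))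

unit : ∀ {n} → Fin n → Fin n → ℚ
unit zero    zero    = 1ℚ
unit zero    (suc _) = 0ℚ
unit (suc _) zero    = 0ℚ
unit (suc j) (suc l) = unit j l

unit-self : ∀ {n} (j : Fin n) → unit j j ≡ 1ℚ
unit-self zero    = refl
unit-self (suc j) = unit-self j

unit-other : ∀ {n} (j l : Fin n) → j ≢ l → unit j l ≡ 0ℚ
unit-other zero    zero    j≢l = ⊥-elim (j≢l refl)
unit-other zero    (suc l) j≢l = refl
unit-other (suc j) zero    j≢l = refl
unit-other (suc j) (suc l) j≢l = unit-other j l (λ e → j≢l (cong suc e))

unit-sift : ∀ {n} (j : Fin n) (c : Fin n → ℚ) → unit j · c ≡ c j
unit-sift {suc n} zero c = begin
  1ℚ * c zero + ∑[ l < n ] (0ℚ * c (suc l))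
    ≡⟨ cong (1ℚ * c zero +_) (sym (*-distribˡ-sum 0ℚ (λ l → c (suc l)))) ⟩
  1ℚ * c zero + 0ℚ * sum (λ l → c (suc l))
    ≡⟨ solve 2 (λ a s → con 1ℚ :* a :+ con 0ℚ :* s := a) refl (c zero) (sum (λ l → c (suc l))) ⟩
  c zero ∎
  where open ≡-Reasoning
unit-sift {suc n} (suc j) c =
  trans (cong₂ _+_ (*-zeroˡ (c zero)) (unit-sift j (λ l → c (suc l))))
        (solve 1 (λ a → con 0ℚ :+ a := a) refl (c (suc j)))

transfer : ∀ {n} → Fin n → Fin n → (Fin n → ℚ) → Fin n → ℚ
transfer i j y l = y l + y i * (unit j l - unit i l)

transfer-· : ∀ {n} (i j : Fin n) y c → transfer i j y · c ≡ y · c + y i * (c j - c i)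
transfer-· {n} i j y c = begin
  transfer i j y · c
    ≡⟨ sum-cong-≗ (λ l → solve 5 (λ a b d e f → (a :+ b :* (d :- e)) :* f :=
         a :* f :+ (b :* (d :* f) :+ (:- b) :* (e :* f))) refl
         (y l) (y i) (unit j l) (unit i l) (c l)) ⟩
  ∑[ l < n ] (y l * c l + shift l)
    ≡⟨ trans (∑-distrib-+ (λ l → y l * c l) shift)
             (cong (y · c +_) (∑-distrib-+ toTarget fromSource)) ⟩
  y · c + (sum toTarget + sum fromSource)
    ≡⟨ cong (y · c +_) (cong₂ _+_
         (trans (sym (*-distribˡ-sum (y i) (λ l → unit j l * c l))) (cong (y i *_) (unit-sift j c)))
         (trans (sym (*-distribˡ-sum (- y i) (λ l → unit i l * c l))) (cong ((- y i) *_) (unit-sift i c)))) ⟩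
  y · c + (y i * c j + (- y i) * c i)
    ≡⟨ solve 4 (λ s a p q → s :+ (a :* p :+ (:- a) :* q) := s :+ a :* (p :- q)) refl
         (y · c) (y i) (c j) (c i) ⟩
  y · c + y i * (c j - c i) ∎
  where
  open ≡-Reasoning
  toTarget fromSource shift : Fin n → ℚ
  toTarget   l = y i * (unit j l * c l)
  fromSource l = (- y i) * (unit i l * c l)
  shift      l = toTarget l + fromSource l

transfer-neutral : ∀ {n} (i j : Fin n) y c → c i ≡ c j → transfer i j y · c ≡ y · c
transfer-neutral i j y c ci≡cj = trans (transfer-· i j y c)
  (trans (cong (λ z → y · c + y i * (c j - z)) ci≡cj)
         (solve 3 (λ s a p → s :+ a :* (p :- p) := s) refl (y · c) (y i) (c j)))

transfer-source : ∀ {n} (i j : Fin n) y → i ≢ j → transfer i j y i ≡ 0ℚ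
transfer-source i j y i≢j rewrite unit-other j i (≢-sym i≢j) | unit-self i =
  solve 1 (λ a → a :+ a :* (con 0ℚ :- con 1ℚ) := con 0ℚ) refl (y i)

transfer-target : ∀ {n} (i j : Fin n) y → i ≢ j → transfer i j y j ≡ y j + y i
transfer-target i j y i≢j rewrite unit-other i j i≢j | unit-self j =
  solve 2 (λ a b → a :+ b :* (con 1ℚ :- con 0ℚ) := a :+ b) refl (y j) (y i)

transfer-elsewhere : ∀ {n} (i j l : Fin n) y → l ≢ i → l ≢ j → transfer i j y l ≡ y l
transfer-elsewhere i j l y l≢i l≢j
  rewrite unit-other i l (≢-sym l≢i) | unit-other j l (≢-sym l≢j) =
  solve 2 (λ a b → a :+ b :* (con 0ℚ :- con 0ℚ) := a) refl (y l) (y i)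

transfer-mixed : ∀ n (i j : Fin n) y → i ≢ j → IsMixed n y → IsMixed n (transfer i j y)
transfer-mixed n i j y i≢j (y≥0 , ∑y≡1) = nonneg , total
  where
  nonneg : ∀ l → 0ℚ ≤ transfer i j y l
  nonneg l with l ≟ᶠ i | l ≟ᶠ j
  ... | yes refl | _        = subst (0ℚ ≤_) (sym (transfer-source i j y i≢j)) ≤-refl
  ... | no  _    | yes refl = subst (0ℚ ≤_) (sym (transfer-target i j y i≢j))
                                (+-mono-≤ {0ℚ} {y l} {0ℚ} {y i} (y≥0 l) (y≥0 i))
  ... | no l≢i   | no l≢j   = subst (0ℚ ≤_) (sym (transfer-elsewhere i j l y l≢i l≢j)) (y≥0 l)
  -- the total mass is a weighted sum against the constant vector 1,
  -- which a transfer leaves unchanged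
  ∑-as-· : ∀ (z : Fin n → ℚ) → ∑ n z ≡ z · (λ _ → 1ℚ)
  ∑-as-· z = trans (∑≡sum n z) (sum-cong-≗ (λ l → sym (*-identityʳ (z l))))
  total : ∑ n (transfer i j y) ≡ 1ℚ
  total = trans (∑-as-· (transfer i j y))
          (trans (transfer-neutral i j y (λ _ → 1ℚ) refl) (trans (sym (∑-as-· y)) ∑y≡1))

payoff-transfer : ∀ {k n} (M : Matrix k n) x y (i j : Fin n) →
  colPayoff M x i ≡ colPayoff M x j → payoff M x (transfer i j y) ≡ payoff M x y
payoff-transfer M x y i j same = begin
  payoff M x (transfer i j y)    ≡⟨ payoff-by-columns M x (transfer i j y) ⟩
  transfer i j y · colPayoff M x ≡⟨ transfer-neutral i j y (colPayoff M x) same ⟩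
  y · colPayoff M x              ≡⟨ payoff-by-columns M x y ⟨
  payoff M x y                   ∎
  where open ≡-Reasoning

module Equilibrium {k n : ℕ} (A B : Matrix k n) (x : Fin k → ℚ) where

  support-best-reply : ∀ y {i j} → IsNash A B x y → 0ℚ < y i → i ≢ j →
    colPayoff B x j ≤ colPayoff B x i
  support-best-reply y {i} {j} (_ , y-mixed , _ , col-opt) yi>0 i≢j =
    gain-bound (y · c) (y i) (c j) (c i) yi>0 (begin
      y · c + y i * (c j - c i)  ≡⟨ transfer-· i j y c ⟨
      transfer i j y · c         ≡⟨ payoff-by-columns B x (transfer i j y) ⟨
      payoff B x (transfer i j y) ≤⟨ col-opt (transfer i j y) (transfer-mixed n i j y i≢j y-mixed) ⟩
      payoff B x y               ≡⟨ payoff-by-columns B x y ⟩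
      y · c                      ∎)
    where
    c : Fin n → ℚ
    c = colPayoff B x
    open Data.Rational.Properties.≤-Reasoning

  support-indifferent : ∀ y {i j} → IsNash A B x y → 0ℚ < y i → 0ℚ < y j → i ≢ j →
    colPayoff B x i ≡ colPayoff B x j
  support-indifferent y nash yi>0 yj>0 i≢j =
    ≤-antisym (support-best-reply y nash yj>0 (≢-sym i≢j)) (support-best-reply y nash yi>0 i≢j)

  transfer-nash : ∀ y {i j} → IsNash A B x y → 0ℚ < y i → 0ℚ < y j → i ≢ j →
    SameColumn A i j → IsNash A B x (transfer i j y)
  transfer-nash y {i} {j} nash@(x-mixed , y-mixed , row-opt , col-opt) yi>0 yj>0 i≢j same =
    x-mixed , transfer-mixed n i j y i≢j y-mixed , row-opt′ , col-opt′
    where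
    A-fixed : ∀ x′ → payoff A x′ (transfer i j y) ≡ payoff A x′ y
    A-fixed x′ = payoff-transfer A x′ y i j (same-column-payoff A x′ same)
    B-fixed : payoff B x (transfer i j y) ≡ payoff B x y
    B-fixed = payoff-transfer B x y i j (support-indifferent y nash yi>0 yj>0 i≢j)
    row-opt′ : ∀ x′ → IsMixed k x′ → payoff A x′ (transfer i j y) ≤ payoff A x (transfer i j y)
    row-opt′ x′ x′-mixed = subst₂ _≤_ (sym (A-fixed x′)) (sym (A-fixed x)) (row-opt x′ x′-mixed)
    col-opt′ : ∀ y′ → IsMixed n y′ → payoff B x y′ ≤ payoff B x (transfer i j y)
    col-opt′ y′ y′-mixed = subst (payoff B x y′ ≤_) (sym B-fixed) (col-opt y′ y′-mixed)

support : ∀ {n} → (Fin n → ℚ) → Subset n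
support y = tabulate (λ l → isYes (0ℚ <? y l))

∈-support⇒positive : ∀ {n} (y : Fin n → ℚ) {l} → l ∈ support y → InSupport y l
∈-support⇒positive y {l} l∈ =
  toWitness (Equivalence.from T-≡ (trans (sym (lookup∘tabulate _ l)) ([]=⇒lookup l∈)))

positive⇒∈-support : ∀ {n} (y : Fin n → ℚ) {l} → InSupport y l → l ∈ support y
positive⇒∈-support y {l} yl>0 =
  lookup⇒[]= l _ (trans (lookup∘tabulate _ l) (Equivalence.to T-≡ (fromWitness yl>0)))

-- A transfer between distinct support columns strictly shrinks the
-- support: the source i leaves it and no column enters it.
transfer-shrinks-support : ∀ {n} (y : Fin n → ℚ) {i j} → InSupport y i → InSupport y j →
  i ≢ j → support (transfer i j y) ⊂ support y
transfer-shrinks-support y {i} {j} yi>0 yj>0 i≢j =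
  kept , i , positive⇒∈-support y yi>0 , i-leaves
  where
  i-leaves : ¬ i ∈ support (transfer i j y)
  i-leaves i∈ = <-irrefl (sym (transfer-source i j y i≢j)) (∈-support⇒positive (transfer i j y) i∈)
  kept : ∀ {l} → l ∈ support (transfer i j y) → l ∈ support y
  kept {l} l∈ with l ≟ᶠ i | l ≟ᶠ j
  ... | yes refl | _        = ⊥-elim (i-leaves l∈)
  ... | no  _    | yes refl = positive⇒∈-support y yj>0
  ... | no l≢i   | no l≢j   = positive⇒∈-support y
    (subst (0ℚ <_) (transfer-elsewhere i j l y l≢i l≢j) (∈-support⇒positive (transfer i j y) l∈))

_≺_ : ∀ {n} → (Fin n → ℚ) → (Fin n → ℚ) → Set
y′ ≺ y = support y′ ⊂ support y

≺-wellFounded : ∀ {n} → WellFounded (_≺_ {n})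
≺-wellFounded = wellFounded-on support ⊂-wellFounded

module Reduction {k n : ℕ} (A B : Matrix k n) (x : Fin k → ℚ) where

  open Equilibrium A B x

  RedundantPair : (Fin n → ℚ) → Set
  RedundantPair y = Σ (Fin n) λ i → Σ (Fin n) λ j →
    InSupport y i × InSupport y j × SameColumn A i j × i ≢ j

  redundantPair? : ∀ y → Dec (RedundantPair y)
  redundantPair? y = any? λ i → any? λ j →
    (0ℚ <? y i) ×-dec (0ℚ <? y j) ×-dec all? (λ r → A r i ≟ A r j) ×-dec ¬? (i ≟ᶠ j)

  no-redundantPair : ∀ y → ¬ RedundantPair y → AtMostOnePerClass A y
  no-redundantPair y none i j yi>0 yj>0 same with i ≟ᶠ j
  ... | yes i≡j = i≡j
  ... | no  i≢j = ⊥-elim (none (i , j , yi>0 , yj>0 , same , i≢j))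

  reduce : ∀ y → Acc _≺_ y → IsNash A B x y →
    Σ (Fin n → ℚ) λ y′ → IsNash A B x y′ × AtMostOnePerClass A y′
  reduce y (acc smaller) nash with redundantPair? y
  ... | no none = y , nash , no-redundantPair y none
  ... | yes (i , j , yi>0 , yj>0 , same , i≢j) =
    reduce (transfer i j y) (smaller (transfer-shrinks-support y yi>0 yj>0 i≢j))
           (transfer-nash y nash yi>0 yj>0 i≢j same)

lemma8 : (k n : ℕ) (A B : Matrix k n) → NonNegMatrix A → NonNegMatrix B →
    (x : Fin k → ℚ) (y : Fin n → ℚ) → IsNash A B x y →
    Σ (Fin k → ℚ) (λ x' → Σ (Fin n → ℚ) (λ y' →
    IsNash A B x' y' × AtMostOnePerClass A y'))
lemma8 k n A B _ _ x y nash = x , Reduction.reduce A B x y (≺-wellFounded y) nash
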